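{- Let $\mathcal{H}$ be a set of graphs and let $G$ be an $\mathcal{H}$-free graph. Then $G$ is strongly $\mathcal{H}$-free if and only if $G$ is $\mathrm{fs}(\mathcal{H})$-free.
   Context: All graphs are finite and simple. For a set of graphs $\mathcal{F}$, a graph is $\mathcal{F}$-free if none of its induced subgraphs is isomorphic to a graph in $\mathcal{F}$, and $\mathcal{F}$-exist otherwise. For an edge $e=uv$ of $G$, the contraction $G/e$ is obtained from $G$ by deleting $u,v$ and adding a new vertex adjacent to every vertex of $(N(u)\cup N(v))\setminus\{u,v\}$; a $G$-contraction is any $G/e$ with $e\in E(G)$. An $\mathcal{H}$-free graph $G$ is strongly $\mathcal{H}$-free if every $G$-contraction is $\mathcal{H}$-free. A graph $J$ is $\mathcal{H}$-free-split if $J$ is $\mathcal{H}$-free and some $J$-contraction is isomorphic to a graph in $\mathcal{H}$; $\mathrm{fs}(\mathcal{H})$ denotes the set of all $\mathcal{H}$-free-split graphs. -}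

module Defs where

open import Data.Nat using (ℕ; zero; suc)
open import Data.Fin using (Fin; zero; suc; punchIn; punchOut)
open import Data.Bool using (Bool; true; false; _∨_)
open import Data.Product using (Σ; _×_; _,_)
open import Data.Unit using (⊤)
open import Data.Empty using (⊥; ⊥-elim)
open import Relation.Nullary using (¬_)
open import Relation.Binary.PropositionalEquality using (_≡_; _≢_; refl; trans; sym)
open import Function.Bundles using (_↔_; Inverse)
open import Function.Definitions using (Injective)

record Graph (n : ℕ) : Set where
  field
    adj    : Fin n → Fin n → Bool
    adj-sym : ∀ i j → adj i j ≡ adj j i
    irrefl : ∀ i → adj i i ≡ false
open Graph public

GraphClass : Set₁
GraphClass = ∀ {n} → Graph n → Set

_≅_ : ∀ {m n} → Graph m → Graph n → Set
_≅_ {m} {n} G H = Σ (Fin m ↔ Fin n) λ φ →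
  ∀ i j → adj H (Inverse.to φ i) (Inverse.to φ j) ≡ adj G i j

induced : ∀ {m n} (G : Graph n) (f : Fin m → Fin n) → Injective _≡_ _≡_ f → Graph m
induced G f _ = record
  { adj = λ i j → adj G (f i) (f j)
  ; adj-sym = λ i j → adj-sym G (f i) (f j)
  ; irrefl = λ i → irrefl G (f i) }

Free : GraphClass → GraphClass
Free 𝓕 {n} G = ∀ m (f : Fin m → Fin n) (inj : Injective _≡_ _≡_ f) →
  ∀ k (F : Graph k) → 𝓕 F → ¬ (induced G f inj ≅ F)

InClass : GraphClass → GraphClass
InClass 𝓕 H = Σ ℕ λ k → Σ (Graph k) λ F → 𝓕 F × (H ≅ F)

IsEdge : ∀ {n} → Graph n → Fin n → Fin n → Set
IsEdge G u v = adj G u v ≡ true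

edge⇒≢ : ∀ {n} (G : Graph n) {u v} → IsEdge G u v → u ≢ v
edge⇒≢ G {u} e refl with trans (sym e) (irrefl G u)
... | ()

-- Contraction G/uv (u ≢ v). The new vertex is zero; vertex (suc j) of G/uv
-- is the j-th vertex of G other than u and v.
contract : ∀ {n} (G : Graph (suc n)) (u v : Fin (suc n)) → u ≢ v → Graph n
contract {zero} G zero zero u≢v = ⊥-elim (u≢v refl)
contract {suc k} G u v u≢v = record { adj = A ; adj-sym = S ; irrefl = I }
  where
    g : Fin k → Fin (suc (suc k))
    g j = punchIn u (punchIn (punchOut u≢v) j)
    A : Fin (suc k) → Fin (suc k) → Bool
    A zero zero = false
    A zero (suc j) = adj G u (g j) ∨ adj G v (g j)
    A (suc i) zero = adj G u (g i) ∨ adj G v (g i)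
    A (suc i) (suc j) = adj G (g i) (g j)
    S : ∀ i j → A i j ≡ A j i
    S zero zero = refl
    S zero (suc j) = refl
    S (suc i) zero = refl
    S (suc i) (suc j) = adj-sym G (g i) (g j)
    I : ∀ i → A i i ≡ false
    I zero = refl
    I (suc i) = irrefl G (g i)

AllContractions : GraphClass → GraphClass
AllContractions P {zero} G = ⊤
AllContractions P {suc n} G =
  ∀ u v (e : IsEdge G u v) → P (contract G u v (edge⇒≢ G e))

SomeContraction : GraphClass → GraphClass
SomeContraction P {zero} G = ⊥
SomeContraction P {suc n} G =
  Σ (Fin (suc n)) λ u → Σ (Fin (suc n)) λ v → Σ (IsEdge G u v) λ e →
    P (contract G u v (edge⇒≢ G e))

StronglyFree : GraphClass → GraphClass
StronglyFree 𝓗 G = Free 𝓗 G × AllContractions (Free 𝓗) G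

fs : GraphClass → GraphClass
fs 𝓗 J = Free 𝓗 J × SomeContraction (InClass 𝓗) J

-- An induced embedding h : J ↪ G carries each contraction J/ab to an induced
-- subgraph of G/h(a)h(b); hence a strongly 𝓗-free G contains no graph of fs(𝓗).
-- Conversely, if some induced subgraph S of G/uv lies in 𝓗, either S avoids the
-- contracted vertex, and then S already sits in G, or it contains it, and then
-- J = G[{u} ∪ S], with the contracted vertex read as v, is an induced subgraph
-- of G (so 𝓗-free) whose contraction J/uv is S, i.e. J ∈ fs(𝓗).
module Submission where

open import Defs
open import Data.Nat using (ℕ; zero; suc)
open import Data.Fin using (Fin; zero; suc; punchIn; punchOut)
open import Data.Fin.Properties
  using (_≟_; any?; ¬Fin0; suc-injective; punchIn-injective; punchInᵢ≢i; punchIn-punchOut)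
open import Data.Fin.Permutation using (insert; id; _⟨$⟩ʳ_)
open import Data.Bool using (_∨_)
open import Data.Product using (∃; _,_; proj₁; proj₂)
open import Data.Unit using (tt)
open import Data.Empty using (⊥-elim)
open import Function.Base using (_∘_)
open import Function.Bundles using (_⇔_; mk⇔; Inverse)
open import Function.Definitions using (Injective)
open import Function.Properties.Inverse using (↔-refl; ↔-trans)
open import Relation.Nullary using (¬_; yes; no)
open import Relation.Binary.PropositionalEquality
  using (_≡_; _≢_; refl; sym; trans; cong; cong₂; subst)

private
  variable
    k m n : ℕ

Fin1-irrelevant : (i j : Fin 1) → i ≡ j
Fin1-irrelevant zero zero = refl

≅-refl : {X : Graph n} → X ≅ X
≅-refl = ↔-refl , λ _ _ → refl

≅-trans : {X : Graph k} {Y : Graph m} {Z : Graph n} → X ≅ Y → Y ≅ Z → X ≅ Z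
≅-trans (φ , φ-adj) (ψ , ψ-adj) = ↔-trans φ ψ , λ i j → trans (ψ-adj _ _) (φ-adj i j)

≅-InClass : {𝓕 : GraphClass} {X : Graph m} {Y : Graph n} → X ≅ Y → InClass 𝓕 Y → InClass 𝓕 X
≅-InClass {X = X} {Y} iso (_ , F , F∈𝓕 , iso′) = _ , F , F∈𝓕 , ≅-trans {X = X} {Y} {F} iso iso′

record Embedding (X : Graph m) (Y : Graph n) : Set where
  field
    vertex           : Fin m → Fin n
    vertex-injective : Injective _≡_ _≡_ vertex
    adj-preserved    : ∀ i j → adj Y (vertex i) (vertex j) ≡ adj X i j
open Embedding

embedding-trans : {X : Graph k} {Y : Graph m} {Z : Graph n} →
  Embedding X Y → Embedding Y Z → Embedding X Z
embedding-trans g h = record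
  { vertex           = vertex h ∘ vertex g
  ; vertex-injective = vertex-injective g ∘ vertex-injective h
  ; adj-preserved    = λ i j → trans (adj-preserved h _ _) (adj-preserved g i j)
  }

induced-embedding : (G : Graph n) (f : Fin m → Fin n) (inj : Injective _≡_ _≡_ f) →
  Embedding (induced G f inj) G
induced-embedding G f inj = record
  { vertex = f ; vertex-injective = inj ; adj-preserved = λ _ _ → refl }

≅⇒embedding⁻ : {X : Graph m} {Y : Graph n} → X ≅ Y → Embedding Y X
≅⇒embedding⁻ {X = X} {Y} (φ , φ-adj) = record
  { vertex           = from
  ; vertex-injective = λ {i} {j} eq →
      trans (sym (strictlyInverseˡ i)) (trans (cong to eq) (strictlyInverseˡ j))
  ; adj-preserved    = λ i j →
      trans (sym (φ-adj (from i) (from j))) (cong₂ (adj Y) (strictlyInverseˡ i) (strictlyInverseˡ j))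
  }
  where open Inverse φ

embedding-edge : {X : Graph m} {Y : Graph n} (h : Embedding X Y) {a b : Fin m} →
  IsEdge X a b → IsEdge Y (vertex h a) (vertex h b)
embedding-edge h {a} {b} e = trans (adj-preserved h a b) e

Free⇒embedded∉ : {𝓕 : GraphClass} {X : Graph m} {Y : Graph n} →
  Free 𝓕 Y → Embedding X Y → ¬ InClass 𝓕 X
Free⇒embedded∉ free h (_ , F , F∈𝓕 , (φ , φ-adj)) =
  free _ (vertex h) (vertex-injective h) _ F F∈𝓕
    (φ , λ i j → trans (φ-adj i j) (sym (adj-preserved h i j)))

Free-antimono : {𝓕 : GraphClass} {X : Graph m} {Y : Graph n} →
  Embedding X Y → Free 𝓕 Y → Free 𝓕 X
Free-antimono {X = X} h free _ f inj _ F F∈𝓕 iso =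
  Free⇒embedded∉ free (embedding-trans (induced-embedding X f inj) h) (_ , F , F∈𝓕 , iso)

module _ {u v : Fin (suc (suc k))} (u≢v : u ≢ v) where

  -- Definitionally the labelling of the old vertices used by contract.
  others : Fin k → Fin (suc (suc k))
  others j = punchIn u (punchIn (punchOut u≢v) j)

  others-injective : Injective _≡_ _≡_ others
  others-injective = punchIn-injective _ _ _ ∘ punchIn-injective u _ _

  others≢u : ∀ j → others j ≢ u
  others≢u j = punchInᵢ≢i u _

  others≢v : ∀ j → others j ≢ v
  others≢v j eq = punchInᵢ≢i (punchOut u≢v) j
    (punchIn-injective u _ _ (trans eq (sym (punchIn-punchOut u≢v))))

  others-surjective : ∀ {w} → w ≢ u → w ≢ v → ∃ λ j → others j ≡ w
  others-surjective {w} w≢u w≢v =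
    punchOut v′≢w′ , trans (cong (punchIn u) (punchIn-punchOut v′≢w′)) (punchIn-punchOut u≢w)
    where
      u≢w : u ≢ w
      u≢w = w≢u ∘ sym
      v′≢w′ : punchOut u≢v ≢ punchOut u≢w
      v′≢w′ eq = w≢v (trans (sym (punchIn-punchOut u≢w))
        (trans (cong (punchIn u) (sym eq)) (punchIn-punchOut u≢v)))

contract-embedding : ∀ {m n} {X : Graph (suc (suc m))} {Y : Graph (suc (suc n))}
  (h : Embedding X Y) {p q : Fin (suc (suc m))}
  (p≢q : p ≢ q) (hp≢hq : vertex h p ≢ vertex h q) →
  Embedding (contract X p q p≢q) (contract Y (vertex h p) (vertex h q) hp≢hq)
contract-embedding {m} {n} {X} {Y} h {p} {q} p≢q hp≢hq = record
  { vertex = vertex′ ; vertex-injective = vertex′-injective ; adj-preserved = vertex′-adj }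
  where
    image : ∀ j → ∃ λ j′ → others hp≢hq j′ ≡ vertex h (others p≢q j)
    image j = others-surjective hp≢hq
      (others≢u p≢q j ∘ vertex-injective h) (others≢v p≢q j ∘ vertex-injective h)

    vertex′ : Fin (suc m) → Fin (suc n)
    vertex′ zero    = zero
    vertex′ (suc j) = suc (proj₁ (image j))

    vertex′-injective : Injective _≡_ _≡_ vertex′
    vertex′-injective {zero}  {zero}  _  = refl
    vertex′-injective {zero}  {suc _} ()
    vertex′-injective {suc _} {zero}  ()
    vertex′-injective {suc i} {suc j} eq = cong suc (others-injective p≢q (vertex-injective h
      (trans (sym (proj₂ (image i)))
        (trans (cong (others hp≢hq) (suc-injective eq)) (proj₂ (image j))))))

    image-adj : ∀ w j → adj Y (vertex h w) (others hp≢hq (proj₁ (image j))) ≡ adj X w (others p≢q j)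
    image-adj w j = trans (cong (adj Y (vertex h w)) (proj₂ (image j))) (adj-preserved h w _)

    vertex′-adj : ∀ i j → adj (contract Y _ _ hp≢hq) (vertex′ i) (vertex′ j) ≡ adj (contract X p q p≢q) i j
    vertex′-adj zero    zero    = refl
    vertex′-adj zero    (suc j) = cong₂ _∨_ (image-adj p j) (image-adj q j)
    vertex′-adj (suc i) zero    = cong₂ _∨_ (image-adj p i) (image-adj q i)
    vertex′-adj (suc i) (suc j) =
      trans (cong₂ (adj Y) (proj₂ (image i)) (proj₂ (image j))) (adj-preserved h _ _)

embedded-contraction∉ : {𝓕 : GraphClass} {X : Graph m} {Y : Graph n} →
  Embedding X Y → AllContractions (Free 𝓕) Y → ¬ SomeContraction (InClass 𝓕) X
embedded-contraction∉ {m = zero} _ _ ()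
embedded-contraction∉ {m = suc zero} {X = X} _ _ (zero , zero , e , _) = edge⇒≢ X e refl
embedded-contraction∉ {m = suc (suc _)} {n = zero} h _ _ = ¬Fin0 (vertex h zero)
embedded-contraction∉ {m = suc (suc _)} {n = suc zero} {Y = Y} h _ (_ , _ , e , _) =
  edge⇒≢ Y (embedding-edge h e) (Fin1-irrelevant _ _)
embedded-contraction∉ {m = suc (suc _)} {n = suc (suc _)} {X = X} {Y} h free (a , b , e , X/ab∈𝓕) =
  Free⇒embedded∉ (free _ _ hab) (contract-embedding h (edge⇒≢ X e) (edge⇒≢ Y hab)) X/ab∈𝓕
  where
    hab : IsEdge Y (vertex h a) (vertex h b)
    hab = embedding-edge h e

AllContractions-Free⇒Free-fs : {𝓗 : GraphClass} {G : Graph n} →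
  AllContractions (Free 𝓗) G → Free (fs 𝓗) G
AllContractions-Free⇒Free-fs {G = G} free _ f inj _ J (_ , J/ab∈𝓗) iso =
  embedded-contraction∉ (embedding-trans (≅⇒embedding⁻ iso) (induced-embedding G f inj)) free J/ab∈𝓗

module _ {k} {G : Graph (suc (suc k))} {u v : Fin (suc (suc k))} (uv : IsEdge G u v) where

  private
    u≢v : u ≢ v
    u≢v = edge⇒≢ G uv

    G/uv : Graph (suc k)
    G/uv = contract G u v u≢v

  uncontract : Fin (suc k) → Fin (suc (suc k))
  uncontract zero    = v
  uncontract (suc j) = others u≢v j

  uncontract-injective : Injective _≡_ _≡_ uncontract
  uncontract-injective {zero}  {zero}  _  = refl
  uncontract-injective {zero}  {suc j} eq = ⊥-elim (others≢v u≢v j (sym eq))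
  uncontract-injective {suc i} {zero}  eq = ⊥-elim (others≢v u≢v i eq)
  uncontract-injective {suc i} {suc j} eq = cong suc (others-injective u≢v eq)

  uncontract≢u : ∀ x → uncontract x ≢ u
  uncontract≢u zero    = u≢v ∘ sym
  uncontract≢u (suc j) = others≢u u≢v j

  uncontract-adj : ∀ {x y} → x ≢ zero → y ≢ zero →
    adj G (uncontract x) (uncontract y) ≡ adj G/uv x y
  uncontract-adj {zero}           x≢0 _   = ⊥-elim (x≢0 refl)
  uncontract-adj {suc _} {zero}   _   y≢0 = ⊥-elim (y≢0 refl)
  uncontract-adj {suc _} {suc _}  _   _   = refl

  contract-adj-new : ∀ {x y} → x ≡ zero → y ≢ zero →
    adj G/uv x y ≡ adj G u (uncontract y) ∨ adj G (uncontract x) (uncontract y)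
  contract-adj-new {y = zero}  _    y≢0 = ⊥-elim (y≢0 refl)
  contract-adj-new {y = suc _} refl _   = refl

  avoiding-embedding : ∀ {m} (f : Fin m → Fin (suc k)) (inj : Injective _≡_ _≡_ f) →
    (∀ i → f i ≢ zero) → Embedding (induced G/uv f inj) G
  avoiding-embedding f inj f≢0 = record
    { vertex           = uncontract ∘ f
    ; vertex-injective = inj ∘ uncontract-injective
    ; adj-preserved    = λ i j → uncontract-adj (f≢0 i) (f≢0 j)
    }

  module _ {m} (f : Fin (suc m) → Fin (suc k)) (inj : Injective _≡_ _≡_ f) where

    expand : Fin (suc (suc m)) → Fin (suc (suc k))
    expand zero    = u
    expand (suc i) = uncontract (f i)

    expand-injective : Injective _≡_ _≡_ expand
    expand-injective {zero}  {zero}  _  = refl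
    expand-injective {zero}  {suc j} eq = ⊥-elim (uncontract≢u (f j) (sym eq))
    expand-injective {suc i} {zero}  eq = ⊥-elim (uncontract≢u (f i) eq)
    expand-injective {suc i} {suc j} eq = cong suc (inj (uncontract-injective eq))

    preimage : Graph (suc (suc m))
    preimage = induced G expand expand-injective

    preimage-edge : ∀ {i₀} → f i₀ ≡ zero → IsEdge preimage zero (suc i₀)
    preimage-edge fi₀≡0 = subst (λ x → adj G u (uncontract x) ≡ _) (sym fi₀≡0) uv

    contract-preimage≅ : ∀ {i₀} → f i₀ ≡ zero → (r : zero ≢ suc i₀) →
      contract preimage zero (suc i₀) r ≅ induced G/uv f inj
    -- The relabelling sends the contracted vertex 0 to i₀ and suc j to punchIn i₀ j.
    contract-preimage≅ {i₀} fi₀≡0 r = insert zero i₀ id , adj-eq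
      where
        f∘punchIn≢0 : ∀ j → f (punchIn i₀ j) ≢ zero
        f∘punchIn≢0 j eq = punchInᵢ≢i i₀ j (inj (trans eq (sym fi₀≡0)))

        adj-eq : ∀ x y → adj G/uv (f (insert zero i₀ id ⟨$⟩ʳ x)) (f (insert zero i₀ id ⟨$⟩ʳ y))
                       ≡ adj (contract preimage zero (suc i₀) r) x y
        adj-eq zero    zero    = irrefl G/uv (f i₀)
        adj-eq zero    (suc j) = contract-adj-new fi₀≡0 (f∘punchIn≢0 j)
        adj-eq (suc i) zero    =
          trans (adj-sym G/uv (f (punchIn i₀ i)) (f i₀)) (contract-adj-new fi₀≡0 (f∘punchIn≢0 i))
        adj-eq (suc i) (suc j) = sym (uncontract-adj (f∘punchIn≢0 i) (f∘punchIn≢0 j))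

  meets-new-vertex∉ : {𝓗 : GraphClass} → Free 𝓗 G → Free (fs 𝓗) G →
    ∀ {m} (f : Fin m → Fin (suc k)) (inj : Injective _≡_ _≡_ f) {i₀ : Fin m} →
    f i₀ ≡ zero → ¬ InClass 𝓗 (induced G/uv f inj)
  meets-new-vertex∉ _ _ {zero} _ _ {()}
  meets-new-vertex∉ {𝓗} free fs-free {suc _} f inj {i₀} fi₀≡0 S∈𝓗 =
    Free⇒embedded∉ fs-free (induced-embedding G (expand f inj) (expand-injective f inj))
      (_ , preimage f inj , (preimage-free , preimage-contraction∈) , ≅-refl {X = preimage f inj})
    where
      preimage-free : Free 𝓗 (preimage f inj)
      preimage-free = Free-antimono (induced-embedding G (expand f inj) (expand-injective f inj)) free

      preimage-contraction∈ : SomeContraction (InClass 𝓗) (preimage f inj)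
      preimage-contraction∈ = zero , suc i₀ , uv′ ,
        ≅-InClass {X = contract (preimage f inj) zero (suc i₀) u′≢v′} {Y = induced G/uv f inj}
          (contract-preimage≅ f inj fi₀≡0 u′≢v′) S∈𝓗
        where
          uv′ : IsEdge (preimage f inj) zero (suc i₀)
          uv′ = preimage-edge f inj fi₀≡0
          u′≢v′ : zero ≢ suc i₀
          u′≢v′ = edge⇒≢ (preimage f inj) uv′

Free-fs⇒AllContractions-Free : {𝓗 : GraphClass} {G : Graph n} →
  Free 𝓗 G → Free (fs 𝓗) G → AllContractions (Free 𝓗) G
Free-fs⇒AllContractions-Free {zero} _ _ = tt
Free-fs⇒AllContractions-Free {suc zero} {G = G} _ _ zero zero e = ⊥-elim (edge⇒≢ G e refl)
Free-fs⇒AllContractions-Free {suc (suc _)} free fs-free u v uv _ f inj _ F F∈𝓗 iso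
  with any? (λ i → f i ≟ zero)
... | yes (_ , fi₀≡0) = meets-new-vertex∉ uv free fs-free f inj fi₀≡0 (_ , F , F∈𝓗 , iso)
... | no avoids = Free⇒embedded∉ free
  (avoiding-embedding uv f inj (λ i fi≡0 → avoids (i , fi≡0))) (_ , F , F∈𝓗 , iso)

proposition3 : (𝓗 : GraphClass) {n : _} (G : Graph n) →
    Free 𝓗 G → (StronglyFree 𝓗 G ⇔ Free (fs 𝓗) G)
proposition3 𝓗 G free = mk⇔
  (AllContractions-Free⇒Free-fs ∘ proj₂)
  (λ fs-free → free , Free-fs⇒AllContractions-Free free fs-free)
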